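{- Let $\mathbb{D}$ be the dodecahedron graph, i.e., the graph formed by the $20$ vertices and $30$ edges of a regular dodecahedron. Then $k(\mathbb{D})=12$.
   Context: All graphs are simple and undirected. The competition graph $C(D)$ of a digraph $D$ is the graph with vertex set $V(D)$ in which two distinct vertices $x,y$ are adjacent if and only if there is a vertex $v$ with $(x,v)$ and $(y,v)$ both arcs of $D$. The competition number $k(G)$ of a graph $G$ is the minimum integer $k\ge 0$ such that $G$ together with $k$ new isolated vertices is the competition graph of some acyclic digraph. -}

module Defs where

open import Level using (0ℓ)
open import Data.Nat using (ℕ; _+_; _≤_; _≡ᵇ_)
open import Data.Bool using (Bool; true; false; _∧_; _∨_)
open import Data.Fin using (Fin; toℕ; splitAt)
open import Data.List using (List; []; _∷_)
open import Data.Bool.ListAction using (any)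
open import Data.Product using (Σ; ∃; _×_; _,_)
open import Data.Sum using (_⊎_; inj₁; inj₂)
open import Data.Empty using (⊥)
open import Relation.Nullary using (¬_)
open import Relation.Binary.PropositionalEquality using (_≡_; _≢_)
open import Relation.Binary.Construct.Closure.Transitive using (Plus)
open import Function.Bundles using (_⇔_)

Digraph : ℕ → Set₁
Digraph m = Fin m → Fin m → Set

-- A simple undirected graph on Fin n is given by an adjacency relation;
-- (symmetry / irreflexivity are properties, checked for the concrete graph below).
Graph : ℕ → Set₁
Graph n = Fin n → Fin n → Set

Acyclic : ∀ {m} → Digraph m → Set
Acyclic D = ∀ x → ¬ Plus D x x

CompAdj : ∀ {m} → Digraph m → Fin m → Fin m → Set
CompAdj D x y = x ≢ y × ∃ λ v → D x v × D y v

-- G together with k new isolated vertices (vertices n, …, n+k-1).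
padHelper : ∀ {n k} → Graph n → Fin n ⊎ Fin k → Fin n ⊎ Fin k → Set
padHelper G (inj₁ i) (inj₁ j) = G i j
padHelper G (inj₁ i) (inj₂ _) = ⊥
padHelper G (inj₂ _) _        = ⊥

Pad : ∀ {n} → Graph n → (k : ℕ) → Graph (n + k)
Pad {n} G k x y = padHelper {n} {k} G (splitAt n x) (splitAt n y)

IsCompRep : ∀ {n} → Graph n → (k : ℕ) → Digraph (n + k) → Set
IsCompRep G k D = Acyclic D × (∀ x y → CompAdj D x y ⇔ Pad G k x y)

HasCompRep : ∀ {n} → Graph n → ℕ → Set₁
HasCompRep {n} G k = Σ (Digraph (n + k)) (IsCompRep G k)

CompetitionNumberIs : ∀ {n} → Graph n → ℕ → Set₁
CompetitionNumberIs G c = HasCompRep G c × (∀ k → HasCompRep G k → c ≤ k)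

-- Dodecahedron graph = generalized Petersen graph GP(10,2):
-- outer vertices u_i = i (i < 10), inner vertices v_i = 10 + i;
-- edges u_i u_{i+1}, u_i v_i, v_i v_{i+2} (indices mod 10). 20 vertices, 30 edges.
dodecEdges : List (ℕ × ℕ)
dodecEdges =
  (0 , 1) ∷ (1 , 2) ∷ (2 , 3) ∷ (3 , 4) ∷ (4 , 5) ∷
  (5 , 6) ∷ (6 , 7) ∷ (7 , 8) ∷ (8 , 9) ∷ (9 , 0) ∷
  (0 , 10) ∷ (1 , 11) ∷ (2 , 12) ∷ (3 , 13) ∷ (4 , 14) ∷
  (5 , 15) ∷ (6 , 16) ∷ (7 , 17) ∷ (8 , 18) ∷ (9 , 19) ∷
  (10 , 12) ∷ (11 , 13) ∷ (12 , 14) ∷ (13 , 15) ∷ (14 , 16) ∷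
  (15 , 17) ∷ (16 , 18) ∷ (17 , 19) ∷ (18 , 10) ∷ (19 , 11) ∷ []

isEdgeℕ : ℕ → ℕ → Bool
isEdgeℕ a b = any (λ { (p , q) → ((p ≡ᵇ a) ∧ (q ≡ᵇ b)) ∨ ((p ≡ᵇ b) ∧ (q ≡ᵇ a)) }) dodecEdges

Dodecahedron : Graph 20
Dodecahedron x y = isEdgeℕ (toℕ x) (toℕ y) ≡ true

-- A triangle-free graph with e ≥ 1 edges and n vertices has competition number at
-- least e − n + 2.  In an acyclic digraph representing it, every edge has a common
-- out-neighbour of its ends (its sink), and triangle-freeness forces different edges
-- to have different sinks.  With fewer than e + 2 vertices at most one vertex is not
-- a sink, so some end of every edge is itself a sink; walking backwards from sink to
-- sink then never stops, which is impossible in a finite acyclic digraph.  For the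
-- dodecahedron this gives k ≥ 30 − 20 + 2 = 12, and 12 suffice: give each of the 30
-- edges its own sink, numbered above both of its ends.

module Submission where

open import Defs
open import Data.Nat as ℕ using (ℕ; zero; suc; _+_; _≤_; _<_; s≤s; z≤n)
open import Data.Nat.Properties
  using (n<1+n; <-trans; <-irrefl; ≤-<-trans; m≤n⇒m<n∨m≡n; ≮⇒≥; +-cancelˡ-≤)
open import Data.Bool using (true)
import Data.Bool.Properties as Bool
open import Data.Fin using (Fin; zero; suc; #_; toℕ; fromℕ<; _↑ˡ_; splitAt)
open import Data.Fin.Properties
  using (_≟_; any?; all?; pigeonhole; injective⇒≤; splitAt-↑ˡ; ↑ˡ-injective)
open import Data.Vec using ([]; _∷_; lookup)
import Data.Vec.Functional as Vector
open import Data.Product using (∃; _×_; _,_; proj₁; proj₂)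
open import Data.Sum using (_⊎_; inj₁; inj₂)
open import Data.Empty using (⊥; ⊥-elim)
open import Function using (id; _∘_)
open import Function.Bundles using (Equivalence; _⇔_; mk⇔)
open import Function.Definitions using (Injective)
open import Relation.Nullary using (¬_; Dec; yes; no; ¬?)
open import Relation.Nullary.Decidable
  using (from-yes; _×-dec_; _⊎-dec_; _→-dec_)
open import Relation.Binary using (Decidable)
open import Relation.Binary.PropositionalEquality
  using (_≡_; _≢_; refl; sym; trans; cong; subst)
open import Relation.Binary.Construct.Closure.Transitive
  using (Plus; [_]; _∼⁺⟨_⟩_)
import Relation.Binary.Construct.Closure.Transitive as Plus

acyclic⇒¬∀-in-neighbour : ∀ {m} {D : Digraph m} → Acyclic D →
                          Fin m → ¬ (∀ v → ∃ λ u → D u v)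
acyclic⇒¬∀-in-neighbour {m} {D} acyclic v₀ in-neighbour =
  let i , j , i<j , walkᵢ≡walkⱼ = pigeonhole (n<1+n m) (walk ∘ toℕ)
  in acyclic (walk (toℕ j)) (subst (Plus D (walk (toℕ j))) walkᵢ≡walkⱼ (walk-back i<j))
  where
  walk : ℕ → Fin m
  walk zero    = v₀
  walk (suc t) = proj₁ (in-neighbour (walk t))

  step : ∀ t → D (walk (suc t)) (walk t)
  step t = proj₂ (in-neighbour (walk t))

  walk-back : ∀ {s t} → s < t → Plus D (walk t) (walk s)
  walk-back {s} {suc t} (s≤s s≤t) with m≤n⇒m<n∨m≡n s≤t
  ... | inj₁ s<t  = _ ∼⁺⟨ [ step t ] ⟩ walk-back s<t
  ... | inj₂ refl = [ step s ]

acyclic-pullback : ∀ {m e} {D : Digraph m} (f : Fin e → Fin m) →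
                   Acyclic D → Acyclic (λ i j → D (f i) (f j))
acyclic-pullback f acyclic i cycle = acyclic (f i) (Plus.map id cycle)

toℕ-increasing⇒acyclic : ∀ {m} {D : Digraph m} →
                         (∀ {u v} → D u v → toℕ u < toℕ v) → Acyclic D
toℕ-increasing⇒acyclic {D = D} increasing v cycle = <-irrefl refl (increasing⁺ cycle)
  where
  increasing⁺ : ∀ {u v} → Plus D u v → toℕ u < toℕ v
  increasing⁺ [ uv ]           = increasing uv
  increasing⁺ (_ ∼⁺⟨ p ⟩ q) = <-trans (increasing⁺ p) (increasing⁺ q)

injective-misses-at-most-one : ∀ {e m} (f : Fin e → Fin m) → Injective _≡_ _≡_ f →
                               m < 2 + e → ∀ y z →
                               (∀ i → f i ≢ y) → (∀ i → f i ≢ z) → y ≡ z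
injective-misses-at-most-one {e} {m} f f-injective m<2+e y z f≢y f≢z with y ≟ z
... | yes y≡z = y≡z
... | no y≢z  = ⊥-elim (<-irrefl refl (≤-<-trans (injective⇒≤ g-injective) m<2+e))
  where
  g : Fin (2 + e) → Fin m
  g = y Vector.∷ z Vector.∷ f

  g-injective : Injective _≡_ _≡_ g
  g-injective {zero}        {zero}        _  = refl
  g-injective {zero}        {suc zero}    eq = ⊥-elim (y≢z eq)
  g-injective {zero}        {suc (suc j)} eq = ⊥-elim (f≢y j (sym eq))
  g-injective {suc zero}    {zero}        eq = ⊥-elim (y≢z (sym eq))
  g-injective {suc zero}    {suc zero}    _  = refl
  g-injective {suc zero}    {suc (suc j)} eq = ⊥-elim (f≢z j (sym eq))
  g-injective {suc (suc i)} {zero}        eq = ⊥-elim (f≢y i eq)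
  g-injective {suc (suc i)} {suc zero}    eq = ⊥-elim (f≢z i eq)
  g-injective {suc (suc i)} {suc (suc j)} eq = cong (λ k → suc (suc k)) (f-injective eq)

TriangleFree : ∀ {n} → Graph n → Set
TriangleFree G = ∀ x y z → G x y → G y z → G x z → ⊥

SameEdge : ∀ {n e} (src tgt : Fin e → Fin n) → Fin e → Fin e → Set
SameEdge src tgt i j = (src i ≡ src j × tgt i ≡ tgt j) ⊎ (src i ≡ tgt j × tgt i ≡ src j)

DistinctEdges : ∀ {n e} (src tgt : Fin e → Fin n) → Set
DistinctEdges src tgt = ∀ i j → SameEdge src tgt i j → i ≡ j

Pad-↑ˡ : ∀ {n} (G : Graph n) k x y → Pad G k (x ↑ˡ k) (y ↑ˡ k) ≡ G x y
Pad-↑ˡ {n} G k x y rewrite splitAt-↑ˡ n x k | splitAt-↑ˡ n y k = refl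

module TriangleFreeBound
  {n k e} {G : Graph n} (triangle-free : TriangleFree G)
  (src tgt : Fin e → Fin n) (is-edge : ∀ i → G (src i) (tgt i))
  (distinct : DistinctEdges src tgt)
  {D : Digraph (n + k)} (rep : IsCompRep G k D)
  where

  vertex : Fin n → Fin (n + k)
  vertex x = x ↑ˡ k

  open Equivalence

  acyclic : Acyclic D
  acyclic = proj₁ rep

  common-prey⇒adjacent : ∀ {x y v} → x ≢ y → D (vertex x) v → D (vertex y) v → G x y
  common-prey⇒adjacent {x} {y} {v} x≢y xv yv =
    subst id (Pad-↑ˡ G k x y)
      (to (proj₂ rep (vertex x) (vertex y)) (x≢y ∘ ↑ˡ-injective k x y , v , xv , yv))

  adjacent⇒common-prey : ∀ {x y} → G x y → CompAdj D (vertex x) (vertex y)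
  adjacent⇒common-prey {x} {y} xy =
    from (proj₂ rep (vertex x) (vertex y)) (subst id (sym (Pad-↑ˡ G k x y)) xy)

  sink : Fin e → Fin (n + k)
  sink i = proj₁ (proj₂ (adjacent⇒common-prey (is-edge i)))

  src⇒sink : ∀ i → D (vertex (src i)) (sink i)
  src⇒sink i = proj₁ (proj₂ (proj₂ (adjacent⇒common-prey (is-edge i))))

  tgt⇒sink : ∀ i → D (vertex (tgt i)) (sink i)
  tgt⇒sink i = proj₂ (proj₂ (proj₂ (adjacent⇒common-prey (is-edge i))))

  vertex-src≢vertex-tgt : ∀ i → vertex (src i) ≢ vertex (tgt i)
  vertex-src≢vertex-tgt i = proj₁ (adjacent⇒common-prey (is-edge i))

  src≢tgt : ∀ i → src i ≢ tgt i
  src≢tgt i = vertex-src≢vertex-tgt i ∘ cong vertex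

  -- A third in-neighbour of a sink would close a triangle with the edge.
  prey-of-sink : ∀ i x → D (vertex x) (sink i) → x ≡ src i ⊎ x ≡ tgt i
  prey-of-sink i x x→sink with x ≟ src i | x ≟ tgt i
  ... | yes x≡src | _         = inj₁ x≡src
  ... | no _      | yes x≡tgt = inj₂ x≡tgt
  ... | no x≢src  | no x≢tgt  =
    ⊥-elim (triangle-free (src i) (tgt i) x (is-edge i)
              (common-prey⇒adjacent (x≢tgt ∘ sym) (tgt⇒sink i) x→sink)
              (common-prey⇒adjacent (x≢src ∘ sym) (src⇒sink i) x→sink))

  sink-injective : Injective _≡_ _≡_ sink
  sink-injective {i} {j} sinkᵢ≡sinkⱼ
    with prey-of-sink i (src j) (subst (D _) (sym sinkᵢ≡sinkⱼ) (src⇒sink j))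
       | prey-of-sink i (tgt j) (subst (D _) (sym sinkᵢ≡sinkⱼ) (tgt⇒sink j))
  ... | inj₁ s≡s | inj₂ t≡t = distinct i j (inj₁ (sym s≡s , sym t≡t))
  ... | inj₂ s≡t | inj₁ t≡s = distinct i j (inj₂ (sym t≡s , sym s≡t))
  ... | inj₁ s≡s | inj₁ t≡s = ⊥-elim (src≢tgt j (trans s≡s (sym t≡s)))
  ... | inj₂ s≡t | inj₂ t≡t = ⊥-elim (src≢tgt j (trans s≡t (sym t≡t)))

  -- With fewer than 2 + e vertices at most one vertex is not a sink, so one
  -- endpoint of every edge is itself a sink: every sink has a sink in-neighbour.
  sink-in-neighbour : n + k < 2 + e → ∀ i → ∃ λ j → D (sink j) (sink i)
  sink-in-neighbour small i
    with any? (λ j → sink j ≟ vertex (src i)) | any? (λ j → sink j ≟ vertex (tgt i))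
  ... | yes (j , sinkⱼ≡src) | _ = j , subst (λ u → D u (sink i)) (sym sinkⱼ≡src) (src⇒sink i)
  ... | no _ | yes (j , sinkⱼ≡tgt) = j , subst (λ u → D u (sink i)) (sym sinkⱼ≡tgt) (tgt⇒sink i)
  ... | no src-no-sink | no tgt-no-sink =
    ⊥-elim (vertex-src≢vertex-tgt i
      (injective-misses-at-most-one sink sink-injective small _ _
        (λ j eq → src-no-sink (j , eq)) (λ j eq → tgt-no-sink (j , eq))))

  2+edges≤order+k : 0 < e → 2 + e ≤ n + k
  2+edges≤order+k 0<e = ≮⇒≥ λ small →
    acyclic⇒¬∀-in-neighbour (acyclic-pullback sink acyclic) (fromℕ< 0<e) (sink-in-neighbour small)

Pad? : ∀ {n} {G : Graph n} k → Decidable G → Decidable (Pad G k)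
Pad? {n} {G} k G? x y = padHelper? (splitAt n x) (splitAt n y)
  where
  padHelper? : ∀ a b → Dec (padHelper {n} {k} G a b)
  padHelper? (inj₁ i) (inj₁ j) = G? i j
  padHelper? (inj₁ _) (inj₂ _) = no id
  padHelper? (inj₂ _) _        = no id

CompAdj? : ∀ {m} {D : Digraph m} → Decidable D → Decidable (CompAdj D)
CompAdj? D? x y = ¬? (x ≟ y) ×-dec any? (λ v → D? x v ×-dec D? y v)

adjacent? : Decidable Dodecahedron
adjacent? x y = isEdgeℕ (toℕ x) (toℕ y) Bool.≟ true

dodecahedron-symmetric : ∀ x y → Dodecahedron x y → Dodecahedron y x
dodecahedron-symmetric = from-yes (all? λ x → all? λ y → adjacent? x y →-dec adjacent? y x)

dodecahedron-triangle-free : TriangleFree Dodecahedron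
dodecahedron-triangle-free = from-yes (all? λ x → all? λ y → all? λ z →
  adjacent? x y →-dec adjacent? y z →-dec adjacent? x z →-dec no id)

src tgt : Fin 30 → Fin 20
src = lookup (# 0  ∷ # 1  ∷ # 2  ∷ # 3  ∷ # 4  ∷ # 5  ∷ # 6  ∷ # 7  ∷ # 8  ∷ # 9  ∷
              # 0  ∷ # 1  ∷ # 2  ∷ # 3  ∷ # 4  ∷ # 5  ∷ # 6  ∷ # 7  ∷ # 8  ∷ # 9  ∷
              # 10 ∷ # 11 ∷ # 12 ∷ # 13 ∷ # 14 ∷ # 15 ∷ # 16 ∷ # 17 ∷ # 18 ∷ # 19 ∷ [])
tgt = lookup (# 1  ∷ # 2  ∷ # 3  ∷ # 4  ∷ # 5  ∷ # 6  ∷ # 7  ∷ # 8  ∷ # 9  ∷ # 0  ∷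
              # 10 ∷ # 11 ∷ # 12 ∷ # 13 ∷ # 14 ∷ # 15 ∷ # 16 ∷ # 17 ∷ # 18 ∷ # 19 ∷
              # 12 ∷ # 13 ∷ # 14 ∷ # 15 ∷ # 16 ∷ # 17 ∷ # 18 ∷ # 19 ∷ # 10 ∷ # 11 ∷ [])

src-tgt-adjacent : ∀ i → Dodecahedron (src i) (tgt i)
src-tgt-adjacent = from-yes (all? λ i → adjacent? (src i) (tgt i))

src-tgt-distinct : DistinctEdges src tgt
src-tgt-distinct = from-yes (all? λ i → all? λ j →
  ((src i ≟ src j ×-dec tgt i ≟ tgt j) ⊎-dec (src i ≟ tgt j ×-dec tgt i ≟ src j)) →-dec i ≟ j)

-- Edge i gets its own sink 2 + i, which lies above both of its ends.
edge-sinks : Digraph (20 + 12)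
edge-sinks u zero          = ⊥
edge-sinks u (suc zero)    = ⊥
edge-sinks u (suc (suc i)) = u ≡ src i ↑ˡ 12 ⊎ u ≡ tgt i ↑ˡ 12

edge-sinks? : Decidable edge-sinks
edge-sinks? u zero          = no id
edge-sinks? u (suc zero)    = no id
edge-sinks? u (suc (suc i)) = u ≟ src i ↑ˡ 12 ⊎-dec u ≟ tgt i ↑ˡ 12

endpoints-below-sink : ∀ i → toℕ (src i ↑ˡ 12) < 2 + toℕ i × toℕ (tgt i ↑ˡ 12) < 2 + toℕ i
endpoints-below-sink = from-yes (all? λ i →
  toℕ (src i ↑ˡ 12) ℕ.<? 2 + toℕ i ×-dec toℕ (tgt i ↑ˡ 12) ℕ.<? 2 + toℕ i)

edge-sinks-increasing : ∀ {u v} → edge-sinks u v → toℕ u < toℕ v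
edge-sinks-increasing {v = suc (suc i)} (inj₁ refl) = proj₁ (endpoints-below-sink i)
edge-sinks-increasing {v = suc (suc i)} (inj₂ refl) = proj₂ (endpoints-below-sink i)

edge-sinks-represent : ∀ x y → CompAdj edge-sinks x y ⇔ Pad Dodecahedron 12 x y
edge-sinks-represent x y = mk⇔ (common-sink⇒adjacent x y) (adjacent⇒common-sink x y)
  where
  adjacent-↑ˡ : ∀ a b → Dodecahedron a b → Pad Dodecahedron 12 (a ↑ˡ 12) (b ↑ˡ 12)
  adjacent-↑ˡ a b = subst id (sym (Pad-↑ˡ Dodecahedron 12 a b))

  common-sink⇒adjacent : ∀ x y → CompAdj edge-sinks x y → Pad Dodecahedron 12 x y
  common-sink⇒adjacent x y (x≢y , suc (suc i) , inj₁ refl , inj₁ refl) = ⊥-elim (x≢y refl)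
  common-sink⇒adjacent x y (x≢y , suc (suc i) , inj₁ refl , inj₂ refl) =
    adjacent-↑ˡ (src i) (tgt i) (src-tgt-adjacent i)
  common-sink⇒adjacent x y (x≢y , suc (suc i) , inj₂ refl , inj₁ refl) =
    adjacent-↑ˡ (tgt i) (src i) (dodecahedron-symmetric (src i) (tgt i) (src-tgt-adjacent i))
  common-sink⇒adjacent x y (x≢y , suc (suc i) , inj₂ refl , inj₂ refl) = ⊥-elim (x≢y refl)

  adjacent⇒common-sink : ∀ x y → Pad Dodecahedron 12 x y → CompAdj edge-sinks x y
  adjacent⇒common-sink = from-yes (all? λ x → all? λ y →
    Pad? 12 adjacent? x y →-dec CompAdj? edge-sinks? x y)

dodecahedron-has-rep-12 : HasCompRep Dodecahedron 12
dodecahedron-has-rep-12 =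
  edge-sinks , toℕ-increasing⇒acyclic edge-sinks-increasing , edge-sinks-represent

theorem2p4 : CompetitionNumberIs Dodecahedron 12
theorem2p4 = dodecahedron-has-rep-12 , lower-bound
  where
  lower-bound : ∀ k → HasCompRep Dodecahedron k → 12 ≤ k
  lower-bound k (_ , rep) = +-cancelˡ-≤ 20 12 k
    (TriangleFreeBound.2+edges≤order+k dodecahedron-triangle-free
       src tgt src-tgt-adjacent src-tgt-distinct rep (s≤s z≤n))
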